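{- Let $G$ be a graph satisfying the triangle condition, and let $L$ be a consensus function on $G$ satisfying the axioms (A), (B), (C), (T$^-$). Then $L$ also satisfies the axiom (T).
   Context: Graphs are undirected, simple and connected; $d$ is the distance, $I(u,v)=\{w:d(u,w)+d(w,v)=d(u,v)\}$. $G$ satisfies the triangle condition if for all vertices $u,v,w$ with $1=d(v,w)<d(u,v)=d(u,w)$ there is a common neighbor $x$ of $v$ and $w$ with $d(u,x)=d(u,v)-1$. A profile is a finite sequence of vertices (repetitions allowed), $V^*$ the set of profiles, $\pi\rho$ concatenation. A consensus function is a map $L:V^*\to 2^V\setminus\{\emptyset\}$. Axioms: (A) invariance under permutations of the profile; (B) $L(u,v)=I(u,v)$; (C) if $L(\pi)\cap L(\rho)\neq\emptyset$ then $L(\pi\rho)=L(\pi)\cap L(\rho)$; (T) for any three pairwise adjacent vertices $u,v,w$, $L(u,v,w)=\{u,v,w\}$; (T$^-$) for any three pairwise adjacent vertices $u,v,w$, if $u\in L(u,v,w)$ then $\{u,v,w\}\subseteq L(u,v,w)$. -}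

module Defs where

open import Data.Nat using (ℕ; zero; suc; _+_; _≤_; _<_; _≟_)
open import Data.Fin using (Fin)
open import Data.Fin.Subset using (Subset; _∩_; _∪_; ⁅_⁆; _∈_; _⊆_; Nonempty)
open import Data.Vec using (tabulate)
open import Data.List.NonEmpty using (List⁺; _∷_; toList; _⁺++⁺_; [_]; _∷⁺_)
open import Data.List.Relation.Binary.Permutation.Propositional using (_↭_)
open import Data.List using ([])
open import Data.Product using (Σ; _×_; ∃)
open import Relation.Nullary using (¬_)
open import Relation.Nullary.Decidable using (⌊_⌋)
open import Relation.Binary.PropositionalEquality using (_≡_)

record Graph (n : ℕ) : Set₁ where
  field
    E     : Fin n → Fin n → Set
    sym   : ∀ {u v} → E u v → E v u
    irrefl : ∀ {u} → ¬ E u u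

open Graph public

data Walk {n : ℕ} (G : Graph n) : Fin n → Fin n → ℕ → Set where
  here : ∀ {u} → Walk G u u zero
  step : ∀ {u v w k} → E G u v → Walk G v w k → Walk G u w (suc k)

-- d is the (geodesic) distance of G: d u v is the least length of a u-v walk.
-- Existence of such walks for all u, v expresses that G is connected.
IsDistance : ∀ {n} → Graph n → (Fin n → Fin n → ℕ) → Set
IsDistance G d = ∀ u v → Walk G u v (d u v) × (∀ k → Walk G u v k → d u v ≤ k)

Interval : ∀ {n} → (Fin n → Fin n → ℕ) → Fin n → Fin n → Subset n
Interval d u v = tabulate (λ w → ⌊ d u w + d w v ≟ d u v ⌋)

TriangleCondition : ∀ {n} → Graph n → (Fin n → Fin n → ℕ) → Set
TriangleCondition G d = ∀ u v w → d v w ≡ 1 → 1 < d u v → d u v ≡ d u w →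
  ∃ λ x → E G x v × E G x w × suc (d u x) ≡ d u v

Profile : ℕ → Set
Profile n = List⁺ (Fin n)

record ConsensusFunction (n : ℕ) : Set where
  field
    L        : Profile n → Subset n
    nonempty : ∀ π → Nonempty (L π)

open ConsensusFunction public

module _ {n : ℕ} (G : Graph n) (d : Fin n → Fin n → ℕ) (C : ConsensusFunction n) where

  prof2 : Fin n → Fin n → Profile n
  prof2 u v = u ∷⁺ [ v ]

  prof3 : Fin n → Fin n → Fin n → Profile n
  prof3 u v w = u ∷⁺ v ∷⁺ [ w ]

  triple : Fin n → Fin n → Fin n → Subset n
  triple u v w = ⁅ u ⁆ ∪ ⁅ v ⁆ ∪ ⁅ w ⁆

  AxiomA : Set
  AxiomA = ∀ π ρ → toList π ↭ toList ρ → L C π ≡ L C ρ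

  AxiomB : Set
  AxiomB = ∀ u v → L C (prof2 u v) ≡ Interval d u v

  AxiomC : Set
  AxiomC = ∀ π ρ → Nonempty (L C π ∩ L C ρ) → L C (π ⁺++⁺ ρ) ≡ L C π ∩ L C ρ

  AxiomT : Set
  AxiomT = ∀ u v w → E G u v → E G v w → E G u w → L C (prof3 u v w) ≡ triple u v w

  AxiomT⁻ : Set
  AxiomT⁻ = ∀ u v w → E G u v → E G v w → E G u w →
    u ∈ L C (prof3 u v w) → triple u v w ⊆ L C (prof3 u v w)

{-# OPTIONS --safe #-}
-- Let x ∈ L(u,v,w) for a triangle u v w. The basic move: if x ∈ L(π) ∩ L(σ), y ∈ L(ρ) ∩ L(τ)
-- and πσ is a permutation of ρτ, then x ∈ L(ρ) ∩ L(τ); combined with L(a,b) = I(a,b) this shows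
-- that an x outside the triangle is equidistant from u, v and w. Distance 1 is impossible since
-- then (T⁻) applies to the triangle u x w, and distance ≥ 2 is impossible since the triangle
-- condition yields a common neighbour y of v and w closer to x, which the same move forces to
-- equal x. Hence L(u,v,w) ⊆ {u,v,w}, and (T⁻) at a vertex in the nonempty L(u,v,w) gives ⊇.
module Submission where

open import Defs
open import Data.Nat using (ℕ; zero; suc; _+_; _≤_; _<_; s≤s; z≤n)
open import Data.Nat.Properties
  using (≤-antisym; n≤0⇒n≡0; n≢0⇒n>0; +-comm; +-identityʳ; m≤n⇒m<n∨m≡n; m<1+n⇒m≤n;
         m+n≡0⇒m≡0; m+n≡0⇒n≡0; suc-injective; 0≢1+n)
open import Data.Bool.Properties using (T-≡)
open import Data.Fin using (Fin) renaming (_≟_ to _≟ᶠ_)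
open import Data.Fin.Subset using (_∈_; _⊆_)
open import Data.Fin.Subset.Properties using (x∈⁅x⁆; x∈⁅y⁆⇒x≡y; ⊆-antisym; x∈p∩q⁺; x∈p∩q⁻; x∈p∪q⁺; x∈p∪q⁻)
open import Data.Vec.Properties using (lookup∘tabulate; lookup⇒[]=; []=⇒lookup)
open import Data.List using ([]) renaming (_∷_ to _∷ₗ_)
open import Data.List.NonEmpty using (toList; _⁺++⁺_; [_]; _∷⁺_)
open import Data.List.Relation.Binary.Permutation.Propositional using (_↭_; refl; prep; swap; trans; ↭-sym)
open import Data.List.Relation.Binary.Permutation.Propositional.Properties using (shift; ↭-reverse)
open import Data.Product using (_×_; _,_; proj₁; proj₂)
open import Data.Sum using (_⊎_; inj₁; inj₂; [_,_]′)
open import Data.Empty using (⊥; ⊥-elim)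
open import Function.Bundles using (Equivalence)
open import Relation.Nullary using (yes; no)
open import Relation.Nullary.Decidable using (fromWitness; toWitness)
open import Relation.Binary.PropositionalEquality using (_≡_; _≢_; cong; subst)
  renaming (refl to ≡-refl; sym to ≡-sym; trans to ≡-trans)

m+n≡1⇒m≡0∨n≡0 : ∀ m {n} → m + n ≡ 1 → m ≡ 0 ⊎ n ≡ 0
m+n≡1⇒m≡0∨n≡0 zero    _  = inj₁ ≡-refl
m+n≡1⇒m≡0∨n≡0 (suc m) eq = inj₂ (m+n≡0⇒n≡0 m (suc-injective eq))

snoc : ∀ {n} {G : Graph n} {u v w k} → Walk G u v k → E G v w → Walk G u w (suc k)
snoc here         e = step e here
snoc (step e′ p) e = step e′ (snoc p e)

record Triangle {n} (G : Graph n) (u v w : Fin n) : Set where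
  constructor triangle
  field
    uv : E G u v
    vw : E G v w
    uw : E G u w

module IntervalMembership {n} (d : Fin n → Fin n → ℕ) {u v w : Fin n} where

  ∈-Interval⁺ : d u w + d w v ≡ d u v → w ∈ Interval d u v
  ∈-Interval⁺ eq =
    lookup⇒[]= w _ (≡-trans (lookup∘tabulate _ w) (Equivalence.to T-≡ (fromWitness eq)))

  ∈-Interval⁻ : w ∈ Interval d u v → d u w + d w v ≡ d u v
  ∈-Interval⁻ w∈ =
    toWitness (Equivalence.from T-≡ (≡-trans (≡-sym (lookup∘tabulate _ w)) ([]=⇒lookup w∈)))

module Distance {n} {G : Graph n} {d : Fin n → Fin n → ℕ} (isD : IsDistance G d) where

  open IntervalMembership d public

  d-minimal : ∀ {u v k} → Walk G u v k → d u v ≤ k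
  d-minimal = proj₂ (isD _ _) _

  d-refl : ∀ u → d u u ≡ 0
  d-refl u = n≤0⇒n≡0 (d-minimal {u} here)

  d≡0⇒≡ : ∀ {u v} → d u v ≡ 0 → u ≡ v
  d≡0⇒≡ {u} {v} eq with subst (Walk G u v) eq (proj₁ (isD u v))
  ... | here = ≡-refl

  d≡1⇒E : ∀ {u v} → d u v ≡ 1 → E G u v
  d≡1⇒E {u} {v} eq with subst (Walk G u v) eq (proj₁ (isD u v))
  ... | step e here = e

  E⇒d≡1 : ∀ {u v} → E G u v → d u v ≡ 1
  E⇒d≡1 {u} e = ≤-antisym (d-minimal (step e here))
    (n≢0⇒n>0 λ eq → irrefl G (subst (E G u) (≡-sym (d≡0⇒≡ eq)) e))

  d-step : ∀ {u v w} → E G v w → d u w ≤ suc (d u v)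
  d-step {u} e = d-minimal (snoc (proj₁ (isD u _)) e)

  ∈-Interval-left : ∀ {u v} → u ∈ Interval d u v
  ∈-Interval-left {u} {v} = ∈-Interval⁺ (cong (_+ d u v) (d-refl u))

  ∈-Interval-right : ∀ {u v} → v ∈ Interval d u v
  ∈-Interval-right {u} {v} = ∈-Interval⁺ (≡-trans (cong (d u v +_) (d-refl v)) (+-identityʳ (d u v)))

  Interval-self : ∀ {u w} → w ∈ Interval d u u → w ≡ u
  Interval-self {u} {w} w∈ =
    ≡-sym (d≡0⇒≡ (m+n≡0⇒m≡0 (d u w) (≡-trans (∈-Interval⁻ w∈) (d-refl u))))

  Interval-edge : ∀ {u v w} → E G u v → w ∈ Interval d u v → w ≡ u ⊎ w ≡ v
  Interval-edge {u} {v} {w} e w∈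
    with m+n≡1⇒m≡0∨n≡0 (d u w) (≡-trans (∈-Interval⁻ w∈) (E⇒d≡1 e))
  ... | inj₁ uw≡0 = inj₁ (≡-sym (d≡0⇒≡ uw≡0))
  ... | inj₂ wv≡0 = inj₂ (d≡0⇒≡ wv≡0)

  ∈-Interval-neighbour : ∀ {u v w} → E G w v → suc (d u w) ≡ d u v → w ∈ Interval d u v
  ∈-Interval-neighbour {u} e eq =
    ∈-Interval⁺ (≡-trans (cong (d u _ +_) (E⇒d≡1 e)) (≡-trans (+-comm _ 1) eq))

module Consensus {n} {G : Graph n} {d : Fin n → Fin n → ℕ} {C : ConsensusFunction n}
  (isD : IsDistance G d) (axA : AxiomA G d C) (axB : AxiomB G d C) (axC : AxiomC G d C) where

  open Distance isD

  ∈L-↭ : ∀ {π ρ x} → toList π ↭ toList ρ → x ∈ L C π → x ∈ L C ρ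
  ∈L-↭ {π} {ρ} p = subst (_ ∈_) (axA π ρ p)

  ∈L-pair⁺ : ∀ {u v x} → x ∈ Interval d u v → x ∈ L C (u ∷⁺ [ v ])
  ∈L-pair⁺ {u} {v} = subst (_ ∈_) (≡-sym (axB u v))

  ∈L-pair⁻ : ∀ {u v x} → x ∈ L C (u ∷⁺ [ v ]) → x ∈ Interval d u v
  ∈L-pair⁻ {u} {v} = subst (_ ∈_) (axB u v)

  ∈L-++⁺ : ∀ {π ρ x} → x ∈ L C π → x ∈ L C ρ → x ∈ L C (π ⁺++⁺ ρ)
  ∈L-++⁺ {π} {ρ} {x} x∈π x∈ρ =
    subst (x ∈_) (≡-sym (axC π ρ (x , x∈p∩q⁺ (x∈π , x∈ρ)))) (x∈p∩q⁺ (x∈π , x∈ρ))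

  ∈L-++⁻ : ∀ {π ρ x y} → y ∈ L C π → y ∈ L C ρ → x ∈ L C (π ⁺++⁺ ρ) → x ∈ L C π × x ∈ L C ρ
  ∈L-++⁻ {π} {ρ} {x} {y} y∈π y∈ρ x∈ =
    x∈p∩q⁻ (L C π) (L C ρ) (subst (x ∈_) (axC π ρ (y , x∈p∩q⁺ (y∈π , y∈ρ))) x∈)

  ∈L-exchange : ∀ {π ρ σ τ x y} → x ∈ L C π → x ∈ L C σ → y ∈ L C ρ → y ∈ L C τ →
    toList (π ⁺++⁺ σ) ↭ toList (ρ ⁺++⁺ τ) → x ∈ L C ρ × x ∈ L C τ
  ∈L-exchange x∈π x∈σ y∈ρ y∈τ p = ∈L-++⁻ y∈ρ y∈τ (∈L-↭ p (∈L-++⁺ x∈π x∈σ))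

  ∈L-[_]⁻ : ∀ {u x} → x ∈ L C [ u ] → x ≡ u
  ∈L-[_]⁻ {u} x∈ = Interval-self (∈L-pair⁻ {u = u} (∈L-++⁺ {π = [ u ]} x∈ x∈))

  ∈L-[_]⁺ : ∀ u → u ∈ L C [ u ]
  ∈L-[ u ]⁺ with nonempty C [ u ]
  ... | x , x∈ = subst (_∈ L C [ u ]) ∈L-[ x∈ ]⁻ x∈

  ∈L-replace : ∀ {π v x} → x ∈ L C (v ∷⁺ π) → x ∈ L C (x ∷⁺ π)
  ∈L-replace {π} {v} {x} x∈ with nonempty C (x ∷⁺ π)
  ... | y , y∈ = proj₂ (∈L-exchange (∈L-pair⁺ ∈-Interval-left) x∈ (∈L-pair⁺ ∈-Interval-right) y∈
    (trans (swap x y refl) (trans (prep y (swap x v refl)) (swap y v refl))))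

  ∈L-farther : ∀ {a b c x} → x ∈ L C (a ∷⁺ b ∷⁺ [ c ]) → E G b a → E G b c →
    suc (d x b) ≡ d x a → x ≡ b ⊎ x ≡ c
  ∈L-farther {a} {b} {c} {x} x∈ ba bc eq = Interval-edge bc (∈L-pair⁻ (proj₂
    (∈L-exchange x∈ ∈L-[ x ]⁺ (∈L-pair⁺ (∈-Interval-neighbour ba eq)) (∈L-pair⁺ ∈-Interval-left)
      (shift x (a ∷ₗ b ∷ₗ c ∷ₗ []) []))))

  ∈L-not-farther : ∀ {a b c x} → x ∈ L C (a ∷⁺ b ∷⁺ [ c ]) → E G b a → E G b c →
    x ≢ b → x ≢ c → d x a ≤ d x b
  ∈L-not-farther x∈ ba bc x≢b x≢c with m≤n⇒m<n∨m≡n (d-step ba)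
  ... | inj₁ lt = m<1+n⇒m≤n lt
  ... | inj₂ eq = ⊥-elim ([ x≢b , x≢c ]′ (∈L-farther x∈ ba bc (≡-sym eq)))

  ∈L-equidistant : ∀ {u v w x} → Triangle G u v w → x ∈ L C (u ∷⁺ v ∷⁺ [ w ]) →
    x ≢ u → x ≢ v → x ≢ w → d x u ≡ d x w × d x v ≡ d x w
  ∈L-equidistant {u} {v} {w} (triangle uv vw uw) x∈ x≢u x≢v x≢w =
      ≤-antisym (∈L-not-farther (∈L-↭ (prep u (swap v w refl)) x∈) (sym G uw) (sym G vw) x≢w x≢v)
                (∈L-not-farther (∈L-↭ (shift w (u ∷ₗ v ∷ₗ []) []) x∈) uw uv x≢u x≢v)
    , ≤-antisym (∈L-not-farther (∈L-↭ (↭-sym (shift u (v ∷ₗ w ∷ₗ []) [])) x∈) (sym G vw) (sym G uw) x≢w x≢u)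
                (∈L-not-farther (∈L-↭ (↭-sym (↭-reverse (u ∷ₗ v ∷ₗ w ∷ₗ []))) x∈) vw (sym G uv) x≢v x≢u)

  ∈L-geodesic-neighbour : ∀ {v w x y} → x ∈ L C (x ∷⁺ v ∷⁺ [ w ]) → E G y v → E G y w →
    suc (d x y) ≡ d x v → suc (d x y) ≡ d x w → y ≡ x
  ∈L-geodesic-neighbour {v} {w} {x} x∈ yv yw yv-closer yw-closer = ∈L-[ proj₂
    (∈L-exchange (∈L-pair⁺ (∈-Interval-neighbour yv yv-closer)) (∈L-pair⁺ (∈-Interval-neighbour yw yw-closer))
      x∈ ∈L-[ x ]⁺ (prep x (prep v (swap x w refl)))) ]⁻

module Triangles {n} {G : Graph n} {d : Fin n → Fin n → ℕ} {C : ConsensusFunction n}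
  (isD : IsDistance G d) (tc : TriangleCondition G d)
  (axA : AxiomA G d C) (axB : AxiomB G d C) (axC : AxiomC G d C) (axT⁻ : AxiomT⁻ G d C) where

  open Distance isD
  open Consensus {C = C} isD axA axB axC

  Triangle-rotate : ∀ {u v w} → Triangle G u v w → Triangle G v w u
  Triangle-rotate (triangle uv vw uw) = triangle vw (sym G uw) (sym G uv)

  ∈-triple⁺ : ∀ {u v w x} → x ≡ u ⊎ x ≡ v ⊎ x ≡ w → x ∈ triple G d C u v w
  ∈-triple⁺ {u = u} (inj₁ ≡-refl)         = x∈p∪q⁺ (inj₁ (x∈⁅x⁆ u))
  ∈-triple⁺ {v = v} (inj₂ (inj₁ ≡-refl)) = x∈p∪q⁺ (inj₂ (x∈p∪q⁺ (inj₁ (x∈⁅x⁆ v))))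
  ∈-triple⁺ {w = w} (inj₂ (inj₂ ≡-refl)) = x∈p∪q⁺ (inj₂ (x∈p∪q⁺ (inj₂ (x∈⁅x⁆ w))))

  ∈-triple⁻ : ∀ {u v w x} → x ∈ triple G d C u v w → x ≡ u ⊎ x ≡ v ⊎ x ≡ w
  ∈-triple⁻ {u} {v} {w} x∈ with x∈p∪q⁻ _ _ x∈
  ... | inj₁ x∈u = inj₁ (x∈⁅y⁆⇒x≡y u x∈u)
  ... | inj₂ x∈vw with x∈p∪q⁻ _ _ x∈vw
  ... | inj₁ x∈v = inj₂ (inj₁ (x∈⁅y⁆⇒x≡y v x∈v))
  ... | inj₂ x∈w = inj₂ (inj₂ (x∈⁅y⁆⇒x≡y w x∈w))

  ∈-triple-rotate : ∀ {u v w x} → x ∈ triple G d C u v w → x ∈ triple G d C v w u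
  ∈-triple-rotate x∈ with ∈-triple⁻ x∈
  ... | inj₁ x≡u        = ∈-triple⁺ (inj₂ (inj₂ x≡u))
  ... | inj₂ (inj₁ x≡v) = ∈-triple⁺ (inj₁ x≡v)
  ... | inj₂ (inj₂ x≡w) = ∈-triple⁺ (inj₂ (inj₁ x≡w))

  ∈L-rotate : ∀ {u v w x} → x ∈ L C (u ∷⁺ v ∷⁺ [ w ]) → x ∈ L C (v ∷⁺ w ∷⁺ [ u ])
  ∈L-rotate {u} {v} {w} = ∈L-↭ (↭-sym (shift u (v ∷ₗ w ∷ₗ []) []))

  triple⊆L : ∀ {u v w z} → Triangle G u v w → z ≡ u ⊎ z ≡ v ⊎ z ≡ w → z ∈ L C (u ∷⁺ v ∷⁺ [ w ]) →
    triple G d C u v w ⊆ L C (u ∷⁺ v ∷⁺ [ w ])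
  triple⊆L {u} {v} {w} (triangle uv vw uw) (inj₁ ≡-refl) z∈ = axT⁻ u v w uv vw uw z∈
  triple⊆L {u} {v} {w} t (inj₂ (inj₁ ≡-refl)) z∈ t∈ =
    ∈L-rotate (∈L-rotate (triple⊆L (Triangle-rotate t) (inj₁ ≡-refl) (∈L-rotate z∈) (∈-triple-rotate t∈)))
  triple⊆L {u} {v} {w} t (inj₂ (inj₂ ≡-refl)) z∈ t∈ =
    ∈L-rotate (triple⊆L (Triangle-rotate (Triangle-rotate t)) (inj₁ ≡-refl)
      (∈L-rotate (∈L-rotate z∈)) (∈-triple-rotate (∈-triple-rotate t∈)))

  -- (T⁻) puts w into L(x,u,w) ∋ x; exchanging against the profile v w gives x ∈ I(v,w).
  ∈L-adjacent : ∀ {u v w x} → E G x u → E G u w → E G x w → E G v w →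
    x ∈ L C (v ∷⁺ u ∷⁺ [ w ]) → x ≡ v ⊎ x ≡ w
  ∈L-adjacent {u} {v} {w} {x} xu uw xw vw x∈ = Interval-edge vw (∈L-pair⁻ (proj₁
    (∈L-exchange x∈ (∈L-pair⁺ {v = w} ∈-Interval-left) (∈L-pair⁺ {u = v} ∈-Interval-right) w∈xuw
      (prep v (↭-sym (shift u (w ∷ₗ x ∷ₗ []) (w ∷ₗ [])))))))
    where
    w∈xuw : w ∈ L C (x ∷⁺ u ∷⁺ [ w ])
    w∈xuw = axT⁻ x u w xu uw xw (∈L-replace x∈) (∈-triple⁺ (inj₂ (inj₂ ≡-refl)))

  ∈L-triangle-vertex : ∀ {u v w x} → Triangle G u v w → x ∈ L C (u ∷⁺ v ∷⁺ [ w ]) →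
    x ≡ u ⊎ x ≡ v ⊎ x ≡ w
  ∈L-triangle-vertex {u} {v} {w} {x} t x∈ with x ≟ᶠ u | x ≟ᶠ v | x ≟ᶠ w
  ... | yes x≡u | _       | _       = inj₁ x≡u
  ... | no _    | yes x≡v | _       = inj₂ (inj₁ x≡v)
  ... | no _    | no _    | yes x≡w = inj₂ (inj₂ x≡w)
  ... | no x≢u  | no x≢v  | no x≢w  = ⊥-elim (outsider-absurd (d x w) ≡-refl)
    where
    open Triangle t
    equidistant : d x u ≡ d x w × d x v ≡ d x w
    equidistant = ∈L-equidistant t x∈ x≢u x≢v x≢w

    xu≡xw : d x u ≡ d x w
    xu≡xw = proj₁ equidistant

    xv≡xw : d x v ≡ d x w
    xv≡xw = proj₂ equidistant

    outsider-absurd : ∀ k → d x w ≡ k → ⊥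
    outsider-absurd zero          eq = x≢w (d≡0⇒≡ eq)
    outsider-absurd (suc zero)    eq = [ x≢v , x≢w ]′
      (∈L-adjacent (d≡1⇒E (≡-trans xu≡xw eq)) uw (d≡1⇒E eq) vw (∈L-↭ (swap u v refl) x∈))
    outsider-absurd (suc (suc k)) eq
      with tc x v w (E⇒d≡1 vw) (subst (1 <_) (≡-sym (≡-trans xv≡xw eq)) (s≤s (s≤s z≤n))) xv≡xw
    ... | y , yv , yw , closer with ∈L-geodesic-neighbour (∈L-replace x∈) yv yw closer (≡-trans closer xv≡xw)
    ... | ≡-refl = 0≢1+n (suc-injective
      (≡-trans (cong suc (≡-sym (d-refl x))) (≡-trans closer (≡-trans xv≡xw eq))))

lemma4 : ∀ {n : ℕ} (G : Graph n) (d : Fin n → Fin n → ℕ) (C : ConsensusFunction n) →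
    IsDistance G d → TriangleCondition G d →
    AxiomA G d C → AxiomB G d C → AxiomC G d C → AxiomT⁻ G d C →
    AxiomT G d C
lemma4 G d C isD tc axA axB axC axT⁻ u v w uv vw uw =
  ⊆-antisym (λ x∈ → ∈-triple⁺ (∈L-triangle-vertex t x∈)) (triple⊆L t (∈L-triangle-vertex t z∈) z∈)
  where
  open Triangles {C = C} isD tc axA axB axC axT⁻
  t : Triangle G u v w
  t = triangle uv vw uw

  z∈ : proj₁ (nonempty C (u ∷⁺ v ∷⁺ [ w ])) ∈ L C (u ∷⁺ v ∷⁺ [ w ])
  z∈ = proj₂ (nonempty C (u ∷⁺ v ∷⁺ [ w ]))
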